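{- For every comeager set $G\subseteq 2^\omega\times 2^\omega$ there exist a Silver tree $T\subseteq 2^{<\omega}$ and a dense $G_\delta$ set $B\subseteq 2^\omega$ such that $[T]\times B\subseteq G$.
   Context: A tree is a set $T\subseteq 2^{<\omega}$ closed under initial segments. $T$ is perfect if for every $\sigma\in T$ there is $\tau\supseteq\sigma$ with $\tau^\frown 0,\tau^\frown 1\in T$. $T$ is a Silver tree if it is perfect and there exist $x\in 2^\omega$ and an infinite $A\subseteq\omega$ such that for all $\sigma\in T$ and all $n\in\mathrm{dom}(\sigma)$ with $n\notin A$ we have $\sigma(n)=x(n)$. The body of $T$ is $[T]=\{x\in 2^\omega: \forall n\ (x\restriction n\in T)\}$. -}

module Defs where

open import Data.Bool using (Bool; true; false)
open import Data.Nat using (ℕ; _≤_; _<_)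
open import Data.List using (List; []; _∷_; _++_; map; upTo; length; lookup)
open import Data.Fin using (Fin; toℕ)
open import Data.Product using (Σ; ∃; _×_; _,_)
open import Relation.Nullary using (¬_)
open import Relation.Binary.PropositionalEquality using (_≡_)

Point : Set
Point = ℕ → Bool

Str : Set
Str = List Bool

_↾_ : Point → ℕ → Str
x ↾ n = map x (upTo n)

_≺_ : Str → Point → Set
σ ≺ x = x ↾ length σ ≡ σ

IsOpen₂ : (Point → Point → Set) → Set
IsOpen₂ U = ∀ x y → U x y →
  ∃ λ n → ∀ x' y' → x' ↾ n ≡ x ↾ n → y' ↾ n ≡ y ↾ n → U x' y'

IsDense₂ : (Point → Point → Set) → Set
IsDense₂ U = ∀ (σ τ : Str) → ∃ λ x → ∃ λ y → σ ≺ x × τ ≺ y × U x y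

IsComeager₂ : (Point → Point → Set) → Set₁
IsComeager₂ G = Σ (ℕ → Point → Point → Set) λ U →
  (∀ n → IsOpen₂ (U n)) × (∀ n → IsDense₂ (U n)) ×
  (∀ x y → (∀ n → U n x y) → G x y)

IsOpen : (Point → Set) → Set
IsOpen U = ∀ x → U x → ∃ λ n → ∀ x' → x' ↾ n ≡ x ↾ n → U x'

IsDense : (Point → Set) → Set
IsDense B = ∀ (σ : Str) → ∃ λ x → σ ≺ x × B x

IsGδ : (Point → Set) → Set₁
IsGδ B = Σ (ℕ → Point → Set) λ V →
  (∀ n → IsOpen (V n)) × (∀ x → (B x → ∀ n → V n x) × ((∀ n → V n x) → B x))

Tree : Set₁
Tree = Str → Set

IsTree : Tree → Set
IsTree T = ∀ σ τ → T (σ ++ τ) → T σ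

IsPerfect : Tree → Set
IsPerfect T = T [] × (∀ σ → T σ → ∃ λ τ →
  T ((σ ++ τ) ++ (false ∷ [])) × T ((σ ++ τ) ++ (true ∷ [])))

Infinite : (ℕ → Set) → Set
Infinite A = ∀ m → ∃ λ n → m ≤ n × A n

IsSilver : Tree → Set₁
IsSilver T = IsTree T × IsPerfect T ×
  Σ Point λ x → Σ (ℕ → Set) λ A → Infinite A ×
    (∀ σ → T σ → ∀ (i : Fin (length σ)) → ¬ A (toℕ i) → lookup σ i ≡ x (toℕ i))

Body : Tree → Point → Set
Body T x = ∀ n → T (x ↾ n)

{-# OPTIONS --safe #-}
-- Write G ⊇ ⋂ₖ Uₖ with every Uₖ dense open. Approximations of x are built in stages: stage j
-- starts at coordinate Lⱼ and, for every assignment s of the coordinates below Lⱼ, every k ≤ j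
-- and every start τ of length j, extends the x-approximation (above Lⱼ) and an approximation
-- of y through τ until the product of the two boxes, with the first Lⱼ coordinates of x
-- replaced by s, lies in Uₖ. Only the coordinate where a stage ends is left free, so the tree
-- of strings agreeing with the limit z off the free coordinates is Silver, and every branch
-- of it lies in the x-box for some s at every stage. Hence [T] × ⋂ₖ Vₖ ⊆ G, where Vₖ is the
-- union of the y-boxes of the stages j ≥ k; each Vₖ is open, and dense because every start τ
-- is served, so ⋂ₖ Vₖ is a dense Gδ by the Baire category theorem.
module Submission where

open import Defs
open import Data.Bool using (Bool; true; false)
open import Data.Empty using (⊥-elim)
open import Data.Fin using (Fin; toℕ)
open import Data.List using (List; []; _∷_; _++_; map; length; lookup; applyUpTo; upTo; cartesianProduct)
open import Data.List.Properties using (map-upTo; length-applyUpTo; length-++; ∷-injective)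
open import Data.List.Membership.Propositional using (_∈_)
open import Data.List.Membership.Propositional.Properties using (∈-map⁺; ∈-++⁺ˡ; ∈-++⁺ʳ; ∈-upTo⁺; ∈-cartesianProduct⁺)
open import Data.List.Relation.Unary.All as All using (All; []; _∷_)
open import Data.List.Relation.Unary.Any using (here)
open import Data.Nat
open import Data.Nat.Properties
open import Data.Product using (Σ; ∃; _×_; _,_; proj₁; proj₂)
open import Data.Sum using (inj₁; inj₂)
open import Data.Unit using (⊤; tt)
open import Function using (_∘_; const)
open import Relation.Binary.Definitions using (tri<; tri≈; tri>)
open import Relation.Binary.PropositionalEquality
open import Relation.Nullary using (¬_; yes; no)

infix 4 _≈[_]_
_≈[_]_ : Point → ℕ → Point → Set
x ≈[ n ] y = ∀ i → i < n → x i ≡ y i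

≈-refl : ∀ {x n} → x ≈[ n ] x
≈-refl _ _ = refl

≈-sym : ∀ {x y n} → x ≈[ n ] y → y ≈[ n ] x
≈-sym e i p = sym (e i p)

≈-trans : ∀ {x y w n} → x ≈[ n ] y → y ≈[ n ] w → x ≈[ n ] w
≈-trans e f i p = trans (e i p) (f i p)

≈-weaken : ∀ {x y m n} → m ≤ n → x ≈[ n ] y → x ≈[ m ] y
≈-weaken m≤n e i p = e i (<-≤-trans p m≤n)

applyUpTo-cong : ∀ {x y : Point} n → x ≈[ n ] y → applyUpTo x n ≡ applyUpTo y n
applyUpTo-cong zero    e = refl
applyUpTo-cong (suc n) e = cong₂ _∷_ (e 0 z<s) (applyUpTo-cong n (λ i p → e (suc i) (s<s p)))

applyUpTo-injective : ∀ {x y : Point} n → applyUpTo x n ≡ applyUpTo y n → x ≈[ n ] y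
applyUpTo-injective (suc n) e zero    _       = proj₁ (∷-injective e)
applyUpTo-injective (suc n) e (suc i) (s<s p) = applyUpTo-injective n (proj₂ (∷-injective e)) i p

↾-cong : ∀ {x y} n → x ≈[ n ] y → x ↾ n ≡ y ↾ n
↾-cong {x} {y} n e = trans (map-upTo x n) (trans (applyUpTo-cong n e) (sym (map-upTo y n)))

↾-injective : ∀ {x y} n → x ↾ n ≡ y ↾ n → x ≈[ n ] y
↾-injective {x} {y} n e = applyUpTo-injective n (trans (sym (map-upTo x n)) (trans e (map-upTo y n)))

length-↾ : ∀ x n → length (x ↾ n) ≡ n
length-↾ x n = trans (cong length (map-upTo x n)) (length-applyUpTo x n)

↾-≺⇒≈ : ∀ {p x} n → (p ↾ n) ≺ x → x ≈[ n ] p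
↾-≺⇒≈ {p} {x} n e = ↾-injective n (subst (λ m → x ↾ m ≡ p ↾ n) (length-↾ p n) e)

infixr 5 _∷ₚ_
_∷ₚ_ : Bool → Point → Point
(b ∷ₚ x) zero    = b
(b ∷ₚ x) (suc i) = x i

padded : Str → Point
padded []      = const false
padded (b ∷ σ) = b ∷ₚ padded σ

applyUpTo-padded : ∀ σ → applyUpTo (padded σ) (length σ) ≡ σ
applyUpTo-padded []      = refl
applyUpTo-padded (b ∷ σ) = cong (b ∷_) (applyUpTo-padded σ)

≈padded⇒≺ : ∀ {x} σ → x ≈[ length σ ] padded σ → σ ≺ x
≈padded⇒≺ {x} σ e = trans (map-upTo x _) (trans (applyUpTo-cong _ e) (applyUpTo-padded σ))

allPrefixes : ℕ → List Point
allPrefixes zero    = const false ∷ []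
allPrefixes (suc n) = map (false ∷ₚ_) (allPrefixes n) ++ map (true ∷ₚ_) (allPrefixes n)

∷ₚ-∈-allPrefixes : ∀ {n p} b → p ∈ allPrefixes n → b ∷ₚ p ∈ allPrefixes (suc n)
∷ₚ-∈-allPrefixes false p∈ = ∈-++⁺ˡ (∈-map⁺ (false ∷ₚ_) p∈)
∷ₚ-∈-allPrefixes true  p∈ = ∈-++⁺ʳ _ (∈-map⁺ (true ∷ₚ_) p∈)

allPrefixes-complete : ∀ n x → ∃ λ p → p ∈ allPrefixes n × p ≈[ n ] x
allPrefixes-complete zero    x = const false , here refl , λ _ ()

allPrefixes-complete (suc n) x with allPrefixes-complete n (x ∘ suc)
... | p , p∈ , p≈ = x 0 ∷ₚ p , ∷ₚ-∈-allPrefixes {n} (x 0) p∈ , agree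
  where
  agree : x 0 ∷ₚ p ≈[ suc n ] x
  agree zero    _       = refl
  agree (suc i) (s<s q) = p≈ i q

splice : ℕ → Point → Point → Point
splice L s x i with i <? L
... | yes _ = s i
... | no  _ = x i

splice-cong : ∀ L s {x y n} → x ≈[ n ] y → splice L s x ≈[ n ] splice L s y
splice-cong L s e i p with i <? L
... | yes _ = refl
... | no  _ = e i p

splice-< : ∀ {L} s x {i} → i < L → splice L s x i ≡ s i
splice-< {L} s x {i} i<L with i <? L
... | yes _   = refl
... | no  i≮L = ⊥-elim (i≮L i<L)

splice-≥ : ∀ {L} s x {i} → L ≤ i → splice L s x i ≡ x i
splice-≥ {L} s x {i} L≤i with i <? L
... | yes i<L = ⊥-elim (<⇒≱ i<L L≤i)
... | no  _   = refl

splice-splice : ∀ L s x y i → splice L s (splice L x y) i ≡ splice L s y i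
splice-splice L s x y i with <-≤-connex i L
... | inj₁ i<L = trans (splice-< s _ i<L) (sym (splice-< s y i<L))
... | inj₂ L≤i = trans (splice-≥ s _ L≤i) (trans (splice-≥ x y L≤i) (sym (splice-≥ s y L≤i)))

splice-absorb : ∀ {L s x} → x ≈[ L ] s → ∀ i → splice L s x i ≡ x i
splice-absorb {L} {s} {x} x≈s i with <-≤-connex i L
... | inj₁ i<L = trans (splice-< s x i<L) (sym (x≈s i i<L))
... | inj₂ L≤i = splice-≥ s x L≤i

splice-restore : ∀ {L s p x n} → x ≈[ n ] splice L s p → p ≈[ n ] splice L p x
splice-restore {L} {s} {p} {x} x≈ i i<n with <-≤-connex i L
... | inj₁ i<L = sym (splice-< p x i<L)
... | inj₂ L≤i = trans (sym (splice-≥ s p L≤i)) (trans (sym (x≈ i i<n)) (sym (splice-≥ p x L≤i)))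

≈splice⇒≈ : ∀ {L s p x n} → L ≤ n → x ≈[ n ] splice L s p → x ≈[ L ] s
≈splice⇒≈ {s = s} {p} L≤n x≈ i i<L = trans (x≈ i (<-≤-trans i<L L≤n)) (splice-< s p i<L)

record Approx : Set where
  constructor approx
  field
    len : ℕ
    pt  : Point
open Approx

InBox : Approx → Point → Set
InBox a x = x ≈[ len a ] pt a

infix 4 _⊑_
_⊑_ : Approx → Approx → Set
a ⊑ b = len a ≤ len b × pt a ≈[ len a ] pt b

⊑-refl : ∀ {a} → a ⊑ a
⊑-refl = ≤-refl , ≈-refl

⊑-trans : ∀ {a b c} → a ⊑ b → b ⊑ c → a ⊑ c
⊑-trans (ab , e) (bc , f) = ≤-trans ab bc , ≈-trans e (≈-weaken ab f)

InBox-⊑ : ∀ {a b x} → a ⊑ b → InBox b x → InBox a x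
InBox-⊑ (ab , e) x∈b = ≈-trans (≈-weaken ab x∈b) (≈-sym e)

lengthen : Approx → Approx
lengthen a = approx (suc (len a)) (pt a)

⊑-lengthen : ∀ {a} → a ⊑ lengthen a
⊑-lengthen = n≤1+n _ , ≈-refl

module Limit (s : ℕ → Approx) (s-⊑ : ∀ k → s k ⊑ s (suc k))
             (s-grows : ∀ k → len (s k) < len (s (suc k))) where

  ⊑-chain′ : ∀ {j k} → j ≤′ k → s j ⊑ s k
  ⊑-chain′ ≤′-refl     = ⊑-refl
  ⊑-chain′ (≤′-step p) = ⊑-trans (⊑-chain′ p) (s-⊑ _)

  ⊑-chain : ∀ {j k} → j ≤ k → s j ⊑ s k
  ⊑-chain = ⊑-chain′ ∘ ≤⇒≤′

  k≤len : ∀ k → k ≤ len (s k)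
  k≤len zero    = z≤n
  k≤len (suc k) = ≤-<-trans (k≤len k) (s-grows k)

  limit : Point
  limit i = pt (s (suc i)) i

  limit-inBox : ∀ k → InBox (s k) limit
  limit-inBox k i i<len with ≤-total k (suc i)
  ... | inj₁ k≤ = sym (proj₂ (⊑-chain k≤) i i<len)
  ... | inj₂ ≥k = proj₂ (⊑-chain ≥k) i (k≤len (suc i))

refineInto : ∀ {V} → IsOpen V → IsDense V → (a : Approx) →
             Σ Approx λ b → a ⊑ b × len a < len b × (∀ x → InBox b x → V x)
refineInto V-open V-dense a with V-dense (pt a ↾ len a)
... | y , a≺y , Vy with V-open y Vy
... | m , near =
  approx (suc (m + len a)) y ,
  (≤-trans (m≤n+m _ m) (n≤1+n _) , ≈-sym (↾-≺⇒≈ (len a) a≺y)) ,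
  s≤s (m≤n+m _ m) ,
  λ x x∈ → near x (↾-cong m (≈-weaken (≤-trans (m≤m+n m _) (n≤1+n _)) x∈))

baire : (V : ℕ → Point → Set) → (∀ k → IsOpen (V k)) → (∀ k → IsDense (V k)) →
        IsDense (λ y → ∀ k → V k y)
baire V V-open V-dense σ =
  limit , ≈padded⇒≺ σ (limit-inBox 0) , λ k → proj₂ (proj₂ (proj₂ (step k))) limit (limit-inBox (suc k))
  where
  s : ℕ → Approx
  step : ∀ k → Σ Approx λ b → s k ⊑ b × len (s k) < len b × (∀ x → InBox b x → V k x)
  step k = refineInto (V-open k) (V-dense k) (s k)
  s zero    = approx (length σ) (padded σ)
  s (suc k) = proj₁ (step k)
  open Limit s (proj₁ ∘ proj₂ ∘ step) (proj₁ ∘ proj₂ ∘ proj₂ ∘ step)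

AgreesOff : (ℕ → Set) → Point → Str → Set
AgreesOff A z []      = ⊤
AgreesOff A z (b ∷ σ) = (¬ A 0 → b ≡ z 0) × AgreesOff (A ∘ suc) (z ∘ suc) σ

AgreesOff-++⁻ˡ : ∀ {A z} σ τ → AgreesOff A z (σ ++ τ) → AgreesOff A z σ
AgreesOff-++⁻ˡ []      τ _         = tt
AgreesOff-++⁻ˡ (b ∷ σ) τ (hd , tl) = hd , AgreesOff-++⁻ˡ σ τ tl

AgreesOff-++⁺ : ∀ {A z} σ {τ} → AgreesOff A z σ →
                AgreesOff (A ∘ (length σ +_)) (z ∘ (length σ +_)) τ → AgreesOff A z (σ ++ τ)
AgreesOff-++⁺ []      _         fτ = fτ
AgreesOff-++⁺ (b ∷ σ) (hd , tl) fτ = hd , AgreesOff-++⁺ σ tl fτ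

AgreesOff-applyUpTo : ∀ {A} z n → AgreesOff A z (applyUpTo z n)
AgreesOff-applyUpTo z zero    = tt
AgreesOff-applyUpTo z (suc n) = (λ _ → refl) , AgreesOff-applyUpTo (z ∘ suc) n

AgreesOff-applyUpTo⁻ : ∀ {A z} x n → AgreesOff A z (applyUpTo x n) → ∀ i → i < n → ¬ A i → x i ≡ z i
AgreesOff-applyUpTo⁻ x (suc n) (hd , tl) zero    _       ¬Ai = hd ¬Ai
AgreesOff-applyUpTo⁻ x (suc n) (hd , tl) (suc i) (s<s p) ¬Ai = AgreesOff-applyUpTo⁻ (x ∘ suc) n tl i p ¬Ai

AgreesOff⇒lookup : ∀ {A z} σ → AgreesOff A z σ → ∀ (i : Fin (length σ)) → ¬ A (toℕ i) → lookup σ i ≡ z (toℕ i)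
AgreesOff⇒lookup (b ∷ σ) (hd , tl) Fin.zero    = hd
AgreesOff⇒lookup (b ∷ σ) (hd , tl) (Fin.suc i) = AgreesOff⇒lookup σ tl i

Body-AgreesOff : ∀ {A z x} → Body (AgreesOff A z) x → ∀ i → ¬ A i → x i ≡ z i
Body-AgreesOff {A} {z} {x} x∈T i =
  AgreesOff-applyUpTo⁻ {A} {z} x (suc i) (subst (AgreesOff A z) (map-upTo x (suc i)) (x∈T (suc i))) i ≤-refl

AgreesOff-perfect : ∀ {A} z → Infinite A → IsPerfect (AgreesOff A z)
AgreesOff-perfect {A} z A-infinite = tt , branch
  where
  branch : ∀ σ → AgreesOff A z σ → ∃ λ τ →
           AgreesOff A z ((σ ++ τ) ++ false ∷ []) × AgreesOff A z ((σ ++ τ) ++ true ∷ [])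
  branch σ σ∈T with A-infinite (length σ)
  ... | f , |σ|≤f , Af = τ , extend false , extend true
    where
    τ : Str
    τ = applyUpTo (z ∘ (length σ +_)) (f ∸ length σ)

    στ-length : length (σ ++ τ) + 0 ≡ f
    στ-length = begin
      length (σ ++ τ) + 0           ≡⟨ +-identityʳ _ ⟩
      length (σ ++ τ)               ≡⟨ length-++ σ ⟩
      length σ + length τ           ≡⟨ cong (length σ +_) (length-applyUpTo _ (f ∸ length σ)) ⟩
      length σ + (f ∸ length σ)     ≡⟨ m+[n∸m]≡n |σ|≤f ⟩
      f                             ∎
      where open ≡-Reasoning

    extend : ∀ b → AgreesOff A z ((σ ++ τ) ++ b ∷ [])
    extend b = AgreesOff-++⁺ (σ ++ τ) (AgreesOff-++⁺ σ σ∈T (AgreesOff-applyUpTo _ _))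
                 ((λ ¬Af → ⊥-elim (¬Af (subst A (sym στ-length) Af))) , tt)

AgreesOff-isSilver : ∀ {A} z → Infinite A → IsSilver (AgreesOff A z)
AgreesOff-isSilver {A} z A-infinite =
  AgreesOff-++⁻ˡ , AgreesOff-perfect z A-infinite , z , A , A-infinite , AgreesOff⇒lookup

module DenseConditions {S : Set} (_≼_ : S → S → Set)
                       (≼-refl : ∀ {a} → a ≼ a) (≼-trans : ∀ {a b c} → a ≼ b → b ≼ c → a ≼ c) where

  Dense : (S → Set) → Set
  Dense P = ∀ a → ∃ λ b → a ≼ b × P b

  UpwardClosed : (S → Set) → Set
  UpwardClosed P = ∀ {a b} → a ≼ b → P a → P b

  dense-All : ∀ {I : Set} {P : I → S → Set} → (∀ i → UpwardClosed (P i)) → (∀ i → Dense (P i)) →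
              ∀ is → Dense (λ a → All (λ i → P i a) is)
  dense-All up dense []       a = a , ≼-refl , []
  dense-All up dense (i ∷ is) a with dense i a
  ... | b , a≼b , Pb with dense-All up dense is b
  ...   | c , b≼c , Pc = c , ≼-trans a≼b b≼c , up i b≼c Pb ∷ Pc

infix 4 _⊑²_
_⊑²_ : Approx × Approx → Approx × Approx → Set
(a , b) ⊑² (a′ , b′) = a ⊑ a′ × b ⊑ b′

module Approxes = DenseConditions _⊑_ ⊑-refl ⊑-trans
module ApproxPairs = DenseConditions _⊑²_ (⊑-refl , ⊑-refl) (λ (p , q) (p′ , q′) → ⊑-trans p p′ , ⊑-trans q q′)

_⊠_⊆_ : Approx → Approx → (Point → Point → Set) → Set
a ⊠ b ⊆ R = ∀ x y → InBox a x → InBox b y → R x y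

⊠-⊆-antitone : ∀ {a a′ b b′ R} → a ⊑ a′ → b ⊑ b′ → a ⊠ b ⊆ R → a′ ⊠ b′ ⊆ R
⊠-⊆-antitone a⊑ b⊑ ab⊆ x y x∈ y∈ = ab⊆ x y (InBox-⊑ a⊑ x∈) (InBox-⊑ b⊑ y∈)

withPrefix : ℕ → Point → Approx → Approx
withPrefix L s a = approx (len a) (splice L s (pt a))

withPrefix-⊑ : ∀ L s {a a′} → a ⊑ a′ → withPrefix L s a ⊑ withPrefix L s a′
withPrefix-⊑ L s (≤len , e) = ≤len , splice-cong L s e

module Construction (U : ℕ → Point → Point → Set)
                    (U-open : ∀ k → IsOpen₂ (U k)) (U-dense : ∀ k → IsDense₂ (U k)) where

  Secured : ℕ → Point × ℕ → Approx × Approx → Set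
  Secured L (s , k) (a , b) = withPrefix L s a ⊠ b ⊆ U k

  secured-upward : ∀ L t → ApproxPairs.UpwardClosed (Secured L t)
  secured-upward L (s , k) (a⊑ , b⊑) = ⊠-⊆-antitone (withPrefix-⊑ L s a⊑) b⊑

  secured-dense : ∀ L t → ApproxPairs.Dense (Secured L t)
  -- Density is applied on len a + L coordinates so that x agrees with s below L even if len a < L.
  secured-dense L (s , k) (a , b)
    with U-dense k (splice L s (pt a) ↾ (len a + L)) (pt b ↾ len b)
  ... | x , y , a≺x , b≺y , Uxy with U-open k x y Uxy
  ... | m , near = (approx N (splice L (pt a) x) , approx N y) , (a⊑ , b⊑) , secured
    where
    N = len a + L + len b + m

    x≈ : x ≈[ len a + L ] splice L s (pt a)
    x≈ = ↾-≺⇒≈ (len a + L) a≺x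

    a⊑ : a ⊑ approx N (splice L (pt a) x)
    a⊑ = ≤-trans (m≤m+n (len a) L) (≤-trans (m≤m+n _ (len b)) (m≤m+n _ m)) ,
         ≈-weaken (m≤m+n (len a) L) (splice-restore {L} {s} x≈)

    b⊑ : b ⊑ approx N y
    b⊑ = ≤-trans (m≤n+m (len b) (len a + L)) (m≤m+n _ m) , ≈-sym (↾-≺⇒≈ (len b) b≺y)

    secured : withPrefix L s (approx N (splice L (pt a) x)) ⊠ approx N y ⊆ U k
    secured x′ y′ x′∈ y′∈ = near x′ y′ (↾-cong m x′≈x) (↾-cong m (≈-weaken (m≤n+m m _) y′∈))
      where
      x′≈x : x′ ≈[ m ] x
      x′≈x i i<m = trans (x′∈ i (<-≤-trans i<m (m≤n+m m _)))
                     (trans (splice-splice L s (pt a) x i) (splice-absorb (≈splice⇒≈ {L} {s} {pt a} (m≤n+m L (len a)) x≈) i))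

  tasks : ℕ → ℕ → List (Point × ℕ)
  tasks L j = cartesianProduct (allPrefixes L) (upTo (suc j))

  Served : ℕ → ℕ → Point → Approx → Set
  Served L j τ a = Σ Approx λ b → approx j τ ⊑ b × All (λ t → Secured L t (a , b)) (tasks L j)

  served-upward : ∀ L j τ → Approxes.UpwardClosed (Served L j τ)
  served-upward L j τ a⊑ (b , τ⊑b , secured) =
    b , τ⊑b , All.map (λ {t} → secured-upward L t (a⊑ , ⊑-refl)) secured

  served-dense : ∀ L j τ → Approxes.Dense (Served L j τ)
  served-dense L j τ a
    with ApproxPairs.dense-All (secured-upward L) (secured-dense L) (tasks L j) (a , approx j τ)
  ... | (a′ , b) , (a⊑ , τ⊑b) , secured = a′ , a⊑ , b , τ⊑b , secured

  closeStage : ∀ j a → ∃ λ b → a ⊑ b × All (λ τ → Served (len a) j τ b) (allPrefixes j)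
  closeStage j a = Approxes.dense-All (served-upward (len a) j) (served-dense (len a) j) (allPrefixes j) a

  stage : ℕ → Approx
  stage zero    = approx 0 (const false)
  stage (suc j) = lengthen (proj₁ (closeStage j (stage j)))

  stageEnd : ℕ → Approx
  stageEnd j = proj₁ (closeStage j (stage j))

  stage⊑stageEnd : ∀ j → stage j ⊑ stageEnd j
  stage⊑stageEnd j = proj₁ (proj₂ (closeStage j (stage j)))

  open Limit stage (λ j → ⊑-trans (stage⊑stageEnd j) ⊑-lengthen) (λ j → s≤s (proj₁ (stage⊑stageEnd j)))

  z : Point
  z = limit

  free : ℕ → ℕ
  free j = len (stageEnd j)

  Free : ℕ → Set
  Free i = ∃ λ j → i ≡ free j

  Free-infinite : Infinite Free
  Free-infinite m = free m , ≤-trans (k≤len m) (proj₁ (stage⊑stageEnd m)) , m , refl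

  ¬Free-within-stage : ∀ {i} j → len (stage j) ≤ i → i < free j → ¬ Free i
  ¬Free-within-stage {i} j start≤i i<free (j′ , refl) with <-cmp j′ j
  ... | tri< j′<j _ _ = <⇒≱ (≤-trans (proj₁ (⊑-chain j′<j)) start≤i) ≤-refl
  ... | tri≈ _ refl _ = <-irrefl refl i<free
  ... | tri> _ _ j<j′ =
    <⇒≱ i<free (≤-trans (n≤1+n _) (≤-trans (proj₁ (⊑-chain j<j′)) (proj₁ (stage⊑stageEnd j′))))

  z≈stageEnd : ∀ j → z ≈[ free j ] pt (stageEnd j)
  z≈stageEnd j i i<free = limit-inBox (suc j) i (m<n⇒m<1+n i<free)

  served : ∀ j {τ} → τ ∈ allPrefixes j → Served (len (stage j)) j τ (stageEnd j)
  served j = All.lookup (proj₂ (proj₂ (closeStage j (stage j))))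

  yApprox : ∀ j {τ} → τ ∈ allPrefixes j → Approx
  yApprox j τ∈ = proj₁ (served j τ∈)

  V : ℕ → Point → Set
  V k y = ∃ λ j → k ≤ j × ∃ λ τ → Σ (τ ∈ allPrefixes j) λ τ∈ → InBox (yApprox j τ∈) y

  V-open : ∀ k → IsOpen (V k)
  V-open k y (j , k≤j , τ , τ∈ , y∈) =
    len (yApprox j τ∈) , λ y′ y′↾ → j , k≤j , τ , τ∈ , ≈-trans (↾-injective _ y′↾) y∈

  V-dense : ∀ k → IsDense (V k)
  V-dense k σ with allPrefixes-complete (k + length σ) (padded σ)
  ... | τ , τ∈ , τ≈σ = pt b , ≈padded⇒≺ σ b≈σ , j , m≤m+n k _ , τ , τ∈ , ≈-refl
    where
    j = k + length σ
    b = yApprox j τ∈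
    b≈σ : pt b ≈[ length σ ] padded σ
    b≈σ i i<σ = let i<j = <-≤-trans i<σ (m≤n+m _ k) in
      trans (sym (proj₂ (proj₁ (proj₂ (served j τ∈))) i i<j)) (τ≈σ i i<j)

  product⊆U : ∀ {x y} → (∀ i → ¬ Free i → x i ≡ z i) → (∀ k → V k y) → ∀ k → U k x y
  product⊆U {x} {y} x≈z y∈V k with y∈V k
  ... | j , k≤j , τ , τ∈ , y∈ with allPrefixes-complete (len (stage j)) x
  ...   | s , s∈ , s≈x =
    All.lookup (proj₂ (proj₂ (served j τ∈))) (∈-cartesianProduct⁺ s∈ (∈-upTo⁺ (s≤s k≤j))) x y x∈ y∈
    where
    L = len (stage j)
    x∈ : InBox (withPrefix L s (stageEnd j)) x
    x∈ i i<free with <-≤-connex i L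
    ... | inj₁ i<L = trans (sym (s≈x i i<L)) (sym (splice-< s _ i<L))
    ... | inj₂ L≤i = trans (x≈z i (¬Free-within-stage j L≤i i<free))
                       (trans (z≈stageEnd j i i<free) (sym (splice-≥ s _ L≤i)))

mainTheorem5 : (G : Point → Point → Set) → IsComeager₂ G →
    Σ Tree λ T → Σ (Point → Set) λ B →
      IsSilver T × IsGδ B × IsDense B × (∀ x y → Body T x → B y → G x y)
mainTheorem5 G (U , U-open , U-dense , ⋂U⊆G) =
  AgreesOff Free z , (λ y → ∀ k → V k y) ,
  AgreesOff-isSilver z Free-infinite ,
  (V , V-open , λ _ → (λ y∈B → y∈B) , (λ y∈B → y∈B)) ,
  baire V V-open V-dense ,
  λ x y x∈T y∈B → ⋂U⊆G x y (product⊆U (Body-AgreesOff x∈T) y∈B)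
  where open Construction U U-open U-dense
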